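{- There is $N$ such that for every integer $n\geq N$ the following holds. Let $D=\{1\leq i\leq 2^{n+1}-3,\ i\text{ odd}\}$ and let $U$ be an irreducible solution of the modular system associated to $D$ and $p=2$, of weight $w\geq 2$, with density in $\left[\frac{1}{n},\frac{1}{n-1}\right]$, whose support has exactly $w$ jumps and is written, up to cyclic shift, as $$n_1,\ldots,2^{\ell_1-1}n_1,\ \ldots,\ n_w,\ldots,2^{\ell_w-1}n_w .$$ Then: \begin{itemize} \item[(i)] $\ell_k\leq n+1$ for all $1\leq k\leq w$; \item[(ii)] all $n_k$ are odd; \item[(iii)] if $n_k>2^u$ for some positive integer $u$, then $\ell_k\leq n-u$; \item[(iv)] if $\ell_i\geq n$ for some $i$, then $n_i=1$ and $\ell_j\leq n-1$ for all $j\neq i$; moreover there is at most one $j$ with $\ell_j=n-1$, and in that case $n_j=3$. \end{itemize}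
   Context: For $\ell\geq1$, $E_{D,2}(\ell)$ is the set of tuples $U=(u_d)_{d\in D}\in\{0,\dots,2^\ell-1\}^{|D|}$ with $\sum_D du_d\equiv 0\pmod{2^\ell-1}$ and $\sum_D du_d>0$; such $U$ has length $\ell$, weight $w=\sum_D s_2(u_d)$ ($s_2$ = sum of binary digits), and density $w/\ell$. The shift $\delta$ on $\{0,\dots,2^\ell-1\}$ fixes $2^\ell-1$ and sends any other $i$ to $2i \bmod (2^\ell-1)$, acting coordinatewise. The support is $\varphi_U:\mathbb{Z}/\ell\mathbb{Z}\to\mathbb{N}_{>0}$, $\varphi_U(k)=\frac{1}{2^\ell-1}\sum_D d\,\delta^k(u_d)$; one has $\varphi_U(i+1)\leq 2\varphi_U(i)$, and a jump is an $i$ with strict inequality. $U$ is irreducible if $\varphi_U$ is injective. With exactly $w$ jumps, the support decomposes cyclically into $w$ maximal geometric blocks of ratio $2$, of lengths $\ell_1,\dots,\ell_w$ summing to $\ell$. -}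

module Defs where

open import Data.Nat using (ℕ; zero; suc; _+_; _*_; _∸_; _^_; _≤_; _<_; _%_; _/_; _≡ᵇ_; _<ᵇ_)
open import Data.Fin using (Fin; toℕ) renaming (zero to fzero; suc to fsuc)
open import Data.Bool using (Bool; true; false; if_then_else_)
open import Data.Nat.Divisibility using (_∣_)
open import Data.Product using (_×_)
open import Relation.Binary.PropositionalEquality using (_≡_)

∑ : (m : ℕ) → (Fin m → ℕ) → ℕ
∑ zero    f = 0
∑ (suc m) f = f fzero + ∑ m (λ j → f (fsuc j))

sumTo : ℕ → (ℕ → ℕ) → ℕ
sumTo zero    f = 0
sumTo (suc k) f = sumTo k f + f k

countBelow : ℕ → (ℕ → Bool) → ℕ
countBelow zero    p = 0
countBelow (suc k) p = countBelow k p + (if p k then 1 else 0)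

-- sum of binary digits (fuel n suffices since n < 2^n)
s2-aux : ℕ → ℕ → ℕ
s2-aux zero    n = 0
s2-aux (suc f) n = n % 2 + s2-aux f (n / 2)

s₂ : ℕ → ℕ
s₂ n = s2-aux n n

-- mod / div with a total convention for divisor 0 (never used: 2^ℓ-1 ≥ 1 for ℓ ≥ 1)
modw : ℕ → ℕ → ℕ
modw a zero    = a
modw a (suc m) = a % suc m

divw : ℕ → ℕ → ℕ
divw a zero    = 0
divw a (suc m) = a / suc m

Mod : ℕ → ℕ
Mod ℓ = 2 ^ ℓ ∸ 1

δ : ℕ → ℕ → ℕ
δ ℓ i = if i ≡ᵇ Mod ℓ then i else modw (2 * i) (Mod ℓ)

δ^ : ℕ → ℕ → ℕ → ℕ
δ^ ℓ zero    i = i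
δ^ ℓ (suc k) i = δ ℓ (δ^ ℓ k i)

-- A tuple U = (u_d)_{d ∈ D} is given by m = |D|, an enumeration d : Fin m → ℕ of D,
-- and u : Fin m → ℕ.
total : (m : ℕ) → (Fin m → ℕ) → (Fin m → ℕ) → ℕ
total m d u = ∑ m (λ j → d j * u j)

weight : (m : ℕ) → (Fin m → ℕ) → ℕ
weight m u = ∑ m (λ j → s₂ (u j))

InE : (m : ℕ) → (Fin m → ℕ) → (ℓ : ℕ) → (Fin m → ℕ) → Set
InE m d ℓ u =
  (1 ≤ ℓ) × ((∀ j → u j < 2 ^ ℓ) × ((Mod ℓ ∣ total m d u) × (0 < total m d u)))

-- support φ_U, indexed by ℕ (it is ℓ-periodic, representing ℤ/ℓℤ)
φ : (m : ℕ) → (Fin m → ℕ) → (ℓ : ℕ) → (Fin m → ℕ) → ℕ → ℕ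
φ m d ℓ u k = divw (∑ m (λ j → d j * δ^ ℓ k (u j))) (Mod ℓ)

-- irreducible: φ_U injective on ℤ/ℓℤ = {0,…,ℓ-1}
Irreducible : (m : ℕ) → (Fin m → ℕ) → (ℓ : ℕ) → (Fin m → ℕ) → Set
Irreducible m d ℓ u =
  ∀ i j → i < ℓ → j < ℓ → φ m d ℓ u i ≡ φ m d ℓ u j → i ≡ j

jumps : (m : ℕ) → (Fin m → ℕ) → (ℓ : ℕ) → (Fin m → ℕ) → ℕ
jumps m d ℓ u = countBelow ℓ (λ i → φ m d ℓ u (suc i) <ᵇ 2 * φ m d ℓ u i)

-- The support f (of period ℓ) is written, after cyclic shift by s, as
-- n_0,…,2^{ℓ_0-1} n_0, …, n_{w-1},…,2^{ℓ_{w-1}-1} n_{w-1}  (blocks indexed 0..w-1)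
BlockForm : (f : ℕ → ℕ) (ℓ w s : ℕ) (nb lb : ℕ → ℕ) → Set
BlockForm f ℓ w s nb lb =
  (∀ k → k < w → 1 ≤ lb k) ×
  ((sumTo w lb ≡ ℓ) ×
   (∀ k t → k < w → t < lb k → f (s + sumTo k lb + t) ≡ 2 ^ t * nb k))

-- D = {1 ≤ i ≤ 2^{n+1}-3, i odd}, enumerated as j ↦ 2j+1 for j < 2^n - 1
Dsize : ℕ → ℕ
Dsize n = 2 ^ n ∸ 1

Delt : (n : ℕ) → Fin (Dsize n) → ℕ
Delt n j = suc (2 * toℕ j)

{-# OPTIONS --safe #-}
-- Let C(k) be the sum of the d ∈ D whose binary digit of u_d is carried out when δ^k U is
-- shifted to δ^(k+1) U. Then φ(k+1) + C(k) = 2 φ(k), and the weight of U is the number of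
-- carries over a period. A jump needs a carry, so having as many jumps as the weight leaves at most one
-- carry per step: C(k) is 0 or a single odd d < 2^(n+1). At the end of block k this gives
-- n_(k+1) + c_k = 2^(ℓ_k) n_k with c_k odd, c_k < 2^(n+1); hence every n_k is odd, the n_k are
-- distinct by irreducibility, and (looking at the largest one) every block maximum
-- 2^(ℓ_k - 1) n_k is below 2^(n+1). The deficits n + 1 - ℓ_k therefore sum to at most 2w by
-- the density bound; a block with n_k ≥ 9 has deficit ≥ 3 and at most 9 blocks have n_k < 9,
-- so w ≤ 27 and, for n ≥ 60, any two blocks satisfy ℓ_j + ℓ_k > n + 1. Parts (iii) and (iv)
-- follow by inserting n_k > 2^u into the relation for the block following block k.
module Submission where

open import Defs
open import Data.Nat using (ℕ; zero; suc; _+_; _*_; _∸_; _^_; _≤_; _<_; _>_; _%_; _/_; _≡ᵇ_; _<ᵇ_; z≤n; s≤s; NonZero; >-nonZero; s≤s⁻¹)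
open import Data.Nat.Properties
open import Data.Nat.DivMod
open import Data.Nat.Divisibility using (_∣_; ∣m+n∣m⇒∣n; ∣n⇒∣m*n; m∣m*n; n∣m*n)
open import Data.Nat.Tactic.RingSolver using (solve-∀)
open import Algebra.Properties.CommutativeSemigroup +-commutativeSemigroup using (interchange)
open import Data.Fin using (Fin; toℕ) renaming (zero to fzero; suc to fsuc)
open import Data.Fin.Properties using (toℕ<n)
open import Data.Bool using (Bool; true; false; if_then_else_; T)
open import Data.Product using (_×_; _,_; ∃-syntax; proj₁; proj₂)
open import Data.Sum using (_⊎_; inj₁; inj₂; [_,_]′; map₂)
open import Data.Empty using (⊥; ⊥-elim)
open import Function using (_∘′_)
open import Relation.Nullary using (yes; no)
open import Relation.Binary.Definitions using (tri<; tri≈; tri>)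
open import Relation.Binary.PropositionalEquality

n≡1+[n∸1] : ∀ {n} → 1 ≤ n → n ≡ suc (n ∸ 1)
n≡1+[n∸1] (s≤s _) = refl

2^n*x≡2*[2^[n∸1]*x] : ∀ {n} x → 1 ≤ n → 2 ^ n * x ≡ 2 * (2 ^ (n ∸ 1) * x)
2^n*x≡2*[2^[n∸1]*x] {suc n} x _ = *-assoc 2 (2 ^ n) x

Odd : ℕ → Set
Odd x = ∃[ q ] x ≡ suc (2 * q)

InjectiveBelow : ℕ → (ℕ → ℕ) → Set
InjectiveBelow L g = ∀ i j → i < L → j < L → g i ≡ g j → i ≡ j

Periodic : ℕ → (ℕ → ℕ) → Set
Periodic L g = ∀ k → g (k + L) ≡ g k

ind : Bool → ℕ
ind b = if b then 1 else 0

ind≤1 : ∀ b → ind b ≤ 1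
ind≤1 true  = ≤-refl
ind≤1 false = z≤n

∑-cong : ∀ m {f g : Fin m → ℕ} → (∀ j → f j ≡ g j) → ∑ m f ≡ ∑ m g
∑-cong zero    eq = refl
∑-cong (suc m) eq = cong₂ _+_ (eq fzero) (∑-cong m λ j → eq (fsuc j))

∑-distrib-+ : ∀ m (f g : Fin m → ℕ) → ∑ m (λ j → f j + g j) ≡ ∑ m f + ∑ m g
∑-distrib-+ zero    f g = refl
∑-distrib-+ (suc m) f g = trans (cong (f fzero + g fzero +_) (∑-distrib-+ m (f ∘′ fsuc) (g ∘′ fsuc)))
  (interchange (f fzero) (g fzero) _ _)

*-distribˡ-∑ : ∀ m c (f : Fin m → ℕ) → c * ∑ m f ≡ ∑ m (λ j → c * f j)
*-distribˡ-∑ zero    c f = *-zeroʳ c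
*-distribˡ-∑ (suc m) c f = trans (*-distribˡ-+ c (f fzero) _) (cong (c * f fzero +_) (*-distribˡ-∑ m c (f ∘′ fsuc)))

∑-zero : ∀ m {f : Fin m → ℕ} → (∀ j → f j ≡ 0) → ∑ m f ≡ 0
∑-zero zero    eq = refl
∑-zero (suc m) eq = cong₂ _+_ (eq fzero) (∑-zero m λ j → eq (fsuc j))

∑≡0⇒≡0 : ∀ m (f : Fin m → ℕ) → ∑ m f ≡ 0 → ∀ j → f j ≡ 0
∑≡0⇒≡0 (suc m) f eq fzero    = m+n≡0⇒m≡0 (f fzero) eq
∑≡0⇒≡0 (suc m) f eq (fsuc j) = ∑≡0⇒≡0 m (f ∘′ fsuc) (m+n≡0⇒n≡0 (f fzero) eq) j

∑-*-atMostOne : ∀ m (d t : Fin m → ℕ) → (∀ j → t j ≤ 1) → ∑ m t ≤ 1 →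
  ∑ m (λ j → d j * t j) ≡ 0 ⊎ ∃[ j ] ∑ m (λ j → d j * t j) ≡ d j
∑-*-atMostOne zero    d t t≤1 ∑≤1 = inj₁ refl
∑-*-atMostOne (suc m) d t t≤1 ∑≤1 with t fzero | t≤1 fzero
... | 0 | _ with ∑-*-atMostOne m (d ∘′ fsuc) (t ∘′ fsuc) (λ j → t≤1 (fsuc j)) ∑≤1
...   | inj₁ eq       = inj₁ (cong₂ _+_ (*-zeroʳ (d fzero)) eq)
...   | inj₂ (j , eq) = inj₂ (fsuc j , cong₂ _+_ (*-zeroʳ (d fzero)) eq)
∑-*-atMostOne (suc m) d t t≤1 ∑≤1 | suc (suc _) | s≤s ()
∑-*-atMostOne (suc m) d t t≤1 ∑≤1 | 1 | _ =
  inj₂ (fzero , trans (cong₂ _+_ (*-identityʳ (d fzero)) rest≡0) (+-identityʳ (d fzero)))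
  where
  rest≡0 : ∑ m (λ j → d (fsuc j) * t (fsuc j)) ≡ 0
  rest≡0 = ∑-zero m λ j →
    trans (cong (d (fsuc j) *_) (∑≡0⇒≡0 m (t ∘′ fsuc) (n≤0⇒n≡0 (s≤s⁻¹ ∑≤1)) j)) (*-zeroʳ (d (fsuc j)))

sumTo-cong : ∀ L {f g : ℕ → ℕ} → (∀ k → k < L → f k ≡ g k) → sumTo L f ≡ sumTo L g
sumTo-cong zero    eq = refl
sumTo-cong (suc L) eq = cong₂ _+_ (sumTo-cong L λ k k<L → eq k (m<n⇒m<1+n k<L)) (eq L ≤-refl)

sumTo-distrib-+ : ∀ L (f g : ℕ → ℕ) → sumTo L (λ k → f k + g k) ≡ sumTo L f + sumTo L g
sumTo-distrib-+ zero    f g = refl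
sumTo-distrib-+ (suc L) f g = trans (cong (_+ (f L + g L)) (sumTo-distrib-+ L f g))
  (interchange (sumTo L f) (sumTo L g) (f L) (g L))

*-distribˡ-sumTo : ∀ L c (g : ℕ → ℕ) → c * sumTo L g ≡ sumTo L (λ k → c * g k)
*-distribˡ-sumTo zero    c g = *-zeroʳ c
*-distribˡ-sumTo (suc L) c g = trans (*-distribˡ-+ c (sumTo L g) (g L)) (cong (_+ c * g L) (*-distribˡ-sumTo L c g))

sumTo-const : ∀ L c → sumTo L (λ _ → c) ≡ L * c
sumTo-const zero    c = refl
sumTo-const (suc L) c = trans (cong (_+ c) (sumTo-const L c)) (+-comm (L * c) c)

sumTo-zero : ∀ L {g : ℕ → ℕ} → (∀ k → k < L → g k ≡ 0) → sumTo L g ≡ 0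
sumTo-zero L eq = trans (sumTo-cong L eq) (trans (sumTo-const L 0) (*-zeroʳ L))

sumTo-mono-≤ : ∀ L {f g : ℕ → ℕ} → (∀ k → k < L → f k ≤ g k) → sumTo L f ≤ sumTo L g
sumTo-mono-≤ zero    le = z≤n
sumTo-mono-≤ (suc L) le = +-mono-≤ (sumTo-mono-≤ L λ k k<L → le k (m<n⇒m<1+n k<L)) (le L ≤-refl)

sumTo-≤-≡⇒≡ : ∀ L {f g : ℕ → ℕ} → (∀ k → k < L → f k ≤ g k) → sumTo L f ≡ sumTo L g →
  ∀ k → k < L → f k ≡ g k
sumTo-≤-≡⇒≡ (suc L) {f} {g} le eq k k<1+L with m≤n⇒m<n∨m≡n (le L ≤-refl)
... | inj₁ fL<gL = ⊥-elim (<⇒≢ (+-mono-≤-< (sumTo-mono-≤ L le′) fL<gL) eq)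
  where
  le′ : ∀ k → k < L → f k ≤ g k
  le′ k k<L = le k (m<n⇒m<1+n k<L)
... | inj₂ fL≡gL with m≤n⇒m<n∨m≡n (s≤s⁻¹ k<1+L)
...   | inj₂ refl = fL≡gL
...   | inj₁ k<L  = sumTo-≤-≡⇒≡ L (λ k k<L → le k (m<n⇒m<1+n k<L))
                      (+-cancelʳ-≡ (f L) _ _ (trans eq (cong (sumTo L g +_) (sym fL≡gL)))) k k<L

term≤sumTo : ∀ L (g : ℕ → ℕ) k → k < L → g k ≤ sumTo L g
term≤sumTo (suc L) g k k<1+L with m≤n⇒m<n∨m≡n (s≤s⁻¹ k<1+L)
... | inj₁ k<L  = ≤-trans (term≤sumTo L g k k<L) (m≤m+n _ _)
... | inj₂ refl = m≤n+m (g k) (sumTo L g)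

pair≤sumTo : ∀ L (g : ℕ → ℕ) j k → j < L → k < L → j ≢ k → g j + g k ≤ sumTo L g
pair≤sumTo (suc L) g j k j<1+L k<1+L j≢k with m≤n⇒m<n∨m≡n (s≤s⁻¹ j<1+L) | m≤n⇒m<n∨m≡n (s≤s⁻¹ k<1+L)
... | inj₁ j<L  | inj₁ k<L  = ≤-trans (pair≤sumTo L g j k j<L k<L j≢k) (m≤m+n _ _)
... | inj₁ j<L  | inj₂ refl = +-monoˡ-≤ (g k) (term≤sumTo L g j j<L)
... | inj₂ refl | inj₁ k<L  = subst (_≤ sumTo L g + g j) (+-comm (g k) (g j)) (+-monoˡ-≤ (g j) (term≤sumTo L g k k<L))
... | inj₂ refl | inj₂ refl = ⊥-elim (j≢k refl)

sumTo-monoˡ-≤ : ∀ (g : ℕ → ℕ) {j k} → j ≤ k → sumTo j g ≤ sumTo k g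
sumTo-monoˡ-≤ g {k = zero}  z≤n = z≤n
sumTo-monoˡ-≤ g {k = suc k} j≤1+k with m≤n⇒m<n∨m≡n j≤1+k
... | inj₁ j<1+k = ≤-trans (sumTo-monoˡ-≤ g (s≤s⁻¹ j<1+k)) (m≤m+n _ _)
... | inj₂ refl  = ≤-refl

sumTo-monoˡ-< : ∀ (g : ℕ → ℕ) {j k} → (∀ i → i < k → 1 ≤ g i) → j < k → sumTo j g < sumTo k g
sumTo-monoˡ-< g {j} {suc k} 1≤g j<1+k = subst (_≤ sumTo k g + g k) (+-comm (sumTo j g) 1)
  (+-mono-≤ (sumTo-monoˡ-≤ g (s≤s⁻¹ j<1+k)) (1≤g k ≤-refl))

sumTo-split : ∀ x y (g : ℕ → ℕ) → sumTo (x + y) g ≡ sumTo x g + sumTo y (λ t → g (x + t))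
sumTo-split x zero    g = trans (cong (λ z → sumTo z g) (+-identityʳ x)) (sym (+-identityʳ _))
sumTo-split x (suc y) g = begin
  sumTo (x + suc y) g                                       ≡⟨ cong (λ z → sumTo z g) (+-suc x y) ⟩
  sumTo (x + y) g + g (x + y)                               ≡⟨ cong (_+ g (x + y)) (sumTo-split x y g) ⟩
  sumTo x g + sumTo y (λ t → g (x + t)) + g (x + y)         ≡⟨ +-assoc (sumTo x g) _ _ ⟩
  sumTo x g + (sumTo y (λ t → g (x + t)) + g (x + y))       ∎
  where open ≡-Reasoning

sumTo-head : ∀ L (h : ℕ → ℕ) → sumTo (suc L) h ≡ h 0 + sumTo L (λ t → h (suc t))
sumTo-head zero    h = +-comm 0 (h 0)
sumTo-head (suc L) h = trans (cong (_+ h (suc L)) (sumTo-head L h)) (+-assoc (h 0) _ _)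

sumTo-shift-periodic : ∀ L (g : ℕ → ℕ) → Periodic L g → ∀ a → sumTo L (λ t → g (a + t)) ≡ sumTo L g
sumTo-shift-periodic L g per zero    = refl
sumTo-shift-periodic L g per (suc a) = +-cancelˡ-≡ (g a) _ _ (begin
  g a + sumTo L (λ t → g (suc a + t))           ≡⟨ cong₂ _+_ (cong g (sym (+-identityʳ a)))
                                                         (sumTo-cong L λ t _ → cong g (sym (+-suc a t))) ⟩
  g (a + 0) + sumTo L (λ t → g (a + suc t))     ≡⟨ sumTo-head L (λ t → g (a + t)) ⟨
  sumTo L (λ t → g (a + t)) + g (a + L)         ≡⟨ cong₂ _+_ (sumTo-shift-periodic L g per a) (per a) ⟩
  sumTo L g + g a                               ≡⟨ +-comm (sumTo L g) (g a) ⟩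
  g a + sumTo L g                               ∎)
  where open ≡-Reasoning

∑-sumTo-comm : ∀ m L (F : Fin m → ℕ → ℕ) → ∑ m (λ j → sumTo L (F j)) ≡ sumTo L (λ k → ∑ m (λ j → F j k))
∑-sumTo-comm m zero    F = ∑-zero m (λ _ → refl)
∑-sumTo-comm m (suc L) F = trans (∑-distrib-+ m (λ j → sumTo L (F j)) (λ j → F j L))
  (cong (_+ ∑ m (λ j → F j L)) (∑-sumTo-comm m L F))

countBelow≡sumTo : ∀ L p → countBelow L p ≡ sumTo L (λ i → ind (p i))
countBelow≡sumTo zero    p = refl
countBelow≡sumTo (suc L) p = cong (_+ ind (p L)) (countBelow≡sumTo L p)

injectiveBelow-pred : ∀ {L g} → InjectiveBelow (suc L) g → InjectiveBelow L g
injectiveBelow-pred inj i j i<L j<L = inj i j (m<n⇒m<1+n i<L) (m<n⇒m<1+n j<L)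

count-≡-injective : ∀ L (g : ℕ → ℕ) v → InjectiveBelow L g → sumTo L (λ k → ind (g k ≡ᵇ v)) ≤ 1
count-≡-injective zero    g v inj = z≤n
count-≡-injective (suc L) g v inj with g L ≡ᵇ v in gL≡ᵇv
... | false = subst (_≤ 1) (sym (+-identityʳ _)) (count-≡-injective L g v (injectiveBelow-pred inj))
... | true  = ≤-reflexive (cong (_+ 1) (sumTo-zero L earlier≢v))
  where
  earlier≢v : ∀ k → k < L → ind (g k ≡ᵇ v) ≡ 0
  earlier≢v k k<L with g k ≡ᵇ v in gk≡ᵇv
  ... | false = refl
  ... | true  = ⊥-elim (<⇒≢ k<L (inj k L (m<n⇒m<1+n k<L) ≤-refl
                  (trans (≡ᵇ⇒≡ _ _ (subst T (sym gk≡ᵇv) _)) (sym (≡ᵇ⇒≡ _ _ (subst T (sym gL≡ᵇv) _))))))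

ind[<ᵇ1+]≡ind[<ᵇ]+ind[≡ᵇ] : ∀ x b → ind (x <ᵇ suc b) ≡ ind (x <ᵇ b) + ind (x ≡ᵇ b)
ind[<ᵇ1+]≡ind[<ᵇ]+ind[≡ᵇ] zero    zero    = refl
ind[<ᵇ1+]≡ind[<ᵇ]+ind[≡ᵇ] zero    (suc b) = refl
ind[<ᵇ1+]≡ind[<ᵇ]+ind[≡ᵇ] (suc x) zero    = refl
ind[<ᵇ1+]≡ind[<ᵇ]+ind[≡ᵇ] (suc x) (suc b) = ind[<ᵇ1+]≡ind[<ᵇ]+ind[≡ᵇ] x b

count-<-injective : ∀ L (g : ℕ → ℕ) b → InjectiveBelow L g → sumTo L (λ k → ind (g k <ᵇ b)) ≤ b
count-<-injective L g zero    inj = ≤-reflexive (sumTo-zero L λ k _ → cong ind (<ᵇ-zero (g k)))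
  where
  <ᵇ-zero : ∀ x → (x <ᵇ 0) ≡ false
  <ᵇ-zero zero    = refl
  <ᵇ-zero (suc x) = refl
count-<-injective L g (suc b) inj = begin
  sumTo L (λ k → ind (g k <ᵇ suc b))
    ≡⟨ sumTo-cong L (λ k _ → ind[<ᵇ1+]≡ind[<ᵇ]+ind[≡ᵇ] (g k) b) ⟩
  sumTo L (λ k → ind (g k <ᵇ b) + ind (g k ≡ᵇ b))
    ≡⟨ sumTo-distrib-+ L _ _ ⟩
  sumTo L (λ k → ind (g k <ᵇ b)) + sumTo L (λ k → ind (g k ≡ᵇ b))
    ≤⟨ +-mono-≤ (count-<-injective L g b inj) (count-≡-injective L g b inj) ⟩
  b + 1
    ≡⟨ +-comm b 1 ⟩
  suc b ∎
  where open ≤-Reasoning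

periodic-+* : ∀ L (g : ℕ → ℕ) → Periodic L g → ∀ r q → g (r + q * L) ≡ g r
periodic-+* L g per r zero    = cong g (+-identityʳ r)
periodic-+* L g per r (suc q) = trans (cong g (trans (cong (r +_) (+-comm L (q * L))) (sym (+-assoc r (q * L) L))))
  (trans (per (r + q * L)) (periodic-+* L g per r q))

periodic-% : ∀ L .{{_ : NonZero L}} (g : ℕ → ℕ) → Periodic L g → ∀ k → g k ≡ g (k % L)
periodic-% L g per k = trans (cong g (m≡m%n+[m/n]*n k L)) (periodic-+* L g per (k % L) (k / L))

rotate-cases : ∀ {k n} .{{_ : NonZero n}} → k < n →
  (suc k < n × suc k % n ≡ suc k) ⊎ (suc k ≡ n × suc k % n ≡ 0)
rotate-cases {n = n} k<n with m≤n⇒m<n∨m≡n k<n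
... | inj₁ 1+k<n = inj₁ (1+k<n , m<n⇒m%n≡m 1+k<n)
... | inj₂ 1+k≡n = inj₂ (1+k≡n , trans (%-congˡ 1+k≡n) (n%n≡0 n))

rotate-injective : ∀ n .{{_ : NonZero n}} → InjectiveBelow n (λ k → suc k % n)
rotate-injective n i j i<n j<n eq with rotate-cases i<n | rotate-cases j<n
... | inj₁ (_ , ri) | inj₁ (_ , rj) = suc-injective (trans (sym ri) (trans eq rj))
... | inj₂ (i≡ , _) | inj₂ (j≡ , _) = suc-injective (trans i≡ (sym j≡))
... | inj₁ (_ , ri) | inj₂ (_ , rj) = ⊥-elim (0≢1+n (trans (sym rj) (trans (sym eq) ri)))
... | inj₂ (_ , ri) | inj₁ (_ , rj) = ⊥-elim (0≢1+n (trans (sym ri) (trans eq rj)))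

rotate-surjective : ∀ n .{{_ : NonZero n}} k → k < n → ∃[ K ] (K < n × suc K % n ≡ k)
rotate-surjective (suc n) zero    _     = n , ≤-refl , n%n≡0 (suc n)
rotate-surjective (suc n) (suc k) k<1+n = k , <-trans (n<1+n k) k<1+n , m<n⇒m%n≡m k<1+n

module _ (L : ℕ) .{{_ : NonZero L}} (g : ℕ → ℕ) (per : Periodic L g) where

  periodic-rotate : ∀ a x → x < L → g (suc a + x) ≡ g (a + suc x % L)
  periodic-rotate a x x<L with rotate-cases x<L
  ... | inj₁ (_ , r≡)    = cong g (trans (sym (+-suc a x)) (cong (a +_) (sym r≡)))
  ... | inj₂ (1+x≡L , r≡) = trans (cong g (trans (sym (+-suc a x)) (cong (a +_) 1+x≡L)))
                              (trans (per a) (cong g (sym (trans (cong (a +_) r≡) (+-identityʳ a)))))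

  window-injective : InjectiveBelow L g → ∀ a x y → x < L → y < L → g (a + x) ≡ g (a + y) → x ≡ y
  window-injective inj zero    x y x<L y<L eq = inj x y x<L y<L eq
  window-injective inj (suc a) x y x<L y<L eq = rotate-injective L x y x<L y<L
    (window-injective inj a _ _ (m%n<n (suc x) L) (m%n<n (suc y) L)
      (trans (sym (periodic-rotate a x x<L)) (trans eq (periodic-rotate a y y<L))))

odd-summand : ∀ x {c} z → Odd c → x + c ≡ 2 * z → Odd x
odd-summand zero          z       (q , refl) eq = ⊥-elim (even≢odd z q (sym eq))
odd-summand (suc zero)    z       _          _  = 0 , refl
odd-summand (suc (suc x)) zero    _          ()
odd-summand (suc (suc x)) (suc z) odd-c      eq with odd-summand x z odd-c
  (suc-injective (trans (suc-injective eq) (+-suc z (z + 0))))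
... | q , refl = suc q , cong (suc ∘′ suc) (sym (+-suc q (q + 0)))

argmax : ∀ w → 0 < w → (g : ℕ → ℕ) → ∃[ K ] (K < w × ∀ k → k < w → g k ≤ g K)
argmax (suc zero)    _ g = 0 , ≤-refl , λ { zero _ → ≤-refl ; (suc k) (s≤s ()) }
argmax (suc (suc w)) _ g with argmax (suc w) (s≤s z≤n) g
... | K , K<1+w , max with g K ≤? g (suc w)
...   | yes gK≤ = suc w , ≤-refl , λ k k<2+w →
          [ (λ k<1+w → ≤-trans (max k k<1+w) gK≤) , (λ { refl → ≤-refl }) ]′ (m≤n⇒m<n∨m≡n (s≤s⁻¹ k<2+w))
...   | no  gK≰ = K , m<n⇒m<1+n K<1+w , λ k k<2+w →
          [ max k , (λ { refl → <⇒≤ (≰⇒> gK≰) }) ]′ (m≤n⇒m<n∨m≡n (s≤s⁻¹ k<2+w))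

2^m<2^n⇒m<n : ∀ m n → 2 ^ m < 2 ^ n → m < n
2^m<2^n⇒m<n m n lt with m <? n
... | yes m<n = m<n
... | no  m≮n = ⊥-elim (<⇒≱ lt (^-monoʳ-≤ 2 (≮⇒≥ m≮n)))

exponent-bound : ∀ a c y b → 2 ^ c ≤ y → 2 ^ a * y < 2 ^ b → a + c < b
exponent-bound a c y b 2^c≤y lt = 2^m<2^n⇒m<n (a + c) b
  (≤-<-trans (≤-trans (≤-reflexive (^-distribˡ-+-* 2 a c)) (*-monoʳ-≤ (2 ^ a) 2^c≤y)) lt)

[1+x]/2≤x : ∀ x → suc x / 2 ≤ x
[1+x]/2≤x x = s≤s⁻¹ (m/n<m (suc x) 2 (s≤s (s≤s z≤n)))

s2-aux-0 : ∀ f → s2-aux f 0 ≡ 0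
s2-aux-0 zero    = refl
s2-aux-0 (suc f) = s2-aux-0 f

s2-aux-fuel : ∀ f g x → x ≤ f → x ≤ g → s2-aux f x ≡ s2-aux g x
s2-aux-fuel f       g       zero    _         _         = trans (s2-aux-0 f) (sym (s2-aux-0 g))
s2-aux-fuel (suc f) (suc g) (suc x) (s≤s x≤f) (s≤s x≤g) =
  cong (suc x % 2 +_) (s2-aux-fuel f g (suc x / 2) (≤-trans ([1+x]/2≤x x) x≤f) (≤-trans ([1+x]/2≤x x) x≤g))

s₂-unfold : ∀ x → s₂ (suc x) ≡ suc x % 2 + s₂ (suc x / 2)
s₂-unfold x = cong (suc x % 2 +_) (s2-aux-fuel x (suc x / 2) (suc x / 2) ([1+x]/2≤x x) ≤-refl)

s₂[2y+b]≡b+s₂[y] : ∀ y b → b ≤ 1 → s₂ (2 * y + b) ≡ b + s₂ y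
s₂[2y+b]≡b+s₂[y] zero    0 _ = refl
s₂[2y+b]≡b+s₂[y] zero    1 _ = refl
s₂[2y+b]≡b+s₂[y] zero    (suc (suc _)) (s≤s ())
s₂[2y+b]≡b+s₂[y] (suc y) b b≤1 = begin
  s₂ (2 * suc y + b)                             ≡⟨ s₂-unfold (y + 1 * suc y + b) ⟩
  x % 2 + s₂ (x / 2)                             ≡⟨ cong (λ z → z % 2 + s₂ (z / 2)) x≡b+[1+y]*2 ⟩
  (b + suc y * 2) % 2 + s₂ ((b + suc y * 2) / 2) ≡⟨ cong₂ (λ r q → r + s₂ q) mod≡b div≡1+y ⟩
  b + s₂ (suc y)                                 ∎
  where
  open ≡-Reasoning
  x = 2 * suc y + b
  x≡b+[1+y]*2 : x ≡ b + suc y * 2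
  x≡b+[1+y]*2 = trans (+-comm (2 * suc y) b) (cong (b +_) (*-comm 2 (suc y)))
  mod≡b : (b + suc y * 2) % 2 ≡ b
  mod≡b = trans ([m+kn]%n≡m%n b (suc y) 2) (m<n⇒m%n≡m (s≤s b≤1))
  div≡1+y : (b + suc y * 2) / 2 ≡ suc y
  div≡1+y = trans (+-distrib-/-∣ʳ b (n∣m*n (suc y))) (cong₂ _+_ (m<n⇒m/n≡0 (s≤s b≤1)) (m*n/n≡m (suc y) 2))

≡ᵇ-true : ∀ {x y} → (x ≡ᵇ y) ≡ true → x ≡ y
≡ᵇ-true {x} {y} eq = ≡ᵇ⇒≡ x y (subst T (sym eq) _)

≡ᵇ-false : ∀ {x y} → (x ≡ᵇ y) ≡ false → x ≢ y
≡ᵇ-false {x} {y} eq x≡y = subst T eq (≡⇒≡ᵇ x y x≡y)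

modw+divw : ∀ a M → 0 < M → modw a M + M * divw a M ≡ a
modw+divw a (suc K) _ = sym (trans (m≡m%n+[m/n]*n a (suc K)) (cong (a % suc K +_) (*-comm (a / suc K) (suc K))))

divw-exact : ∀ a M → 0 < M → M ∣ a → M * divw a M ≡ a
divw-exact a (suc K) _ M∣a = m*[n/m]≡n M∣a

modw<divisor : ∀ a M → 0 < M → modw a M < M
modw<divisor a (suc K) _ = m%n<n a (suc K)

divw≤1 : ∀ a M → a < 2 * M → divw a M ≤ 1
divw≤1 a zero    ()
divw≤1 a (suc K) a<2M = s≤s⁻¹ (m<n*o⇒m/o<n {a} {2} {suc K} a<2M)

-- Doubling modulo 2^ℓ - 1 rotates the ℓ binary digits of x; carry is the digit rotated out
-- (the fixed point 2^ℓ - 1 of δ carries 1).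
carry : ℕ → ℕ → ℕ
carry ℓ x = if x ≡ᵇ Mod ℓ then 1 else divw (2 * x) (Mod ℓ)

module _ (ℓ : ℕ) {x : ℕ} (x≤Mod : x ≤ Mod ℓ) where

  private
    M = Mod ℓ

    <Mod : x ≢ M → x < M
    <Mod = ≤∧≢⇒< x≤Mod

  δ+Mod*carry≡2* : δ ℓ x + M * carry ℓ x ≡ 2 * x
  δ+Mod*carry≡2* with x ≡ᵇ M in x≡ᵇM
  ... | true  = cong (x +_) (trans (*-identityʳ M) (trans (sym (≡ᵇ-true x≡ᵇM)) (sym (+-identityʳ x))))
  ... | false = modw+divw (2 * x) M (≤-<-trans z≤n (<Mod (≡ᵇ-false x≡ᵇM)))

  δ≤Mod : δ ℓ x ≤ M
  δ≤Mod with x ≡ᵇ M in x≡ᵇM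
  ... | true  = x≤Mod
  ... | false = <⇒≤ (modw<divisor (2 * x) M (≤-<-trans z≤n (<Mod (≡ᵇ-false x≡ᵇM))))

  carry≤1 : carry ℓ x ≤ 1
  carry≤1 with x ≡ᵇ M in x≡ᵇM
  ... | true  = ≤-refl
  ... | false = divw≤1 (2 * x) M (*-monoʳ-< 2 (<Mod (≡ᵇ-false x≡ᵇM)))

δ^≤Mod : ∀ ℓ k {x} → x ≤ Mod ℓ → δ^ ℓ k x ≤ Mod ℓ
δ^≤Mod ℓ zero    x≤Mod = x≤Mod
δ^≤Mod ℓ (suc k) x≤Mod = δ≤Mod ℓ (δ^≤Mod ℓ k x≤Mod)

δ^-+ : ∀ ℓ a b x → δ^ ℓ (a + b) x ≡ δ^ ℓ a (δ^ ℓ b x)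
δ^-+ ℓ zero    b x = refl
δ^-+ ℓ (suc a) b x = cong (δ ℓ) (δ^-+ ℓ a b x)

δ-Mod : ∀ ℓ → δ ℓ (Mod ℓ) ≡ Mod ℓ
δ-Mod ℓ with Mod ℓ ≡ᵇ Mod ℓ in M≡ᵇM
... | true  = refl
... | false = ⊥-elim (≡ᵇ-false {Mod ℓ} M≡ᵇM refl)

δ^-Mod : ∀ ℓ k → δ^ ℓ k (Mod ℓ) ≡ Mod ℓ
δ^-Mod ℓ zero    = refl
δ^-Mod ℓ (suc k) = trans (cong (δ ℓ) (δ^-Mod ℓ k)) (δ-Mod ℓ)

-- The successive carries read as a binary number; after ℓ steps it is x again (carries-period),
-- which is why s₂ x counts the carries over one period.
carries : ℕ → ℕ → ℕ → ℕ
carries ℓ x zero    = 0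
carries ℓ x (suc r) = 2 * carries ℓ x r + carry ℓ (δ^ ℓ r x)

Mod+1≡2^ : ∀ ℓ → Mod ℓ + 1 ≡ 2 ^ ℓ
Mod+1≡2^ ℓ = m∸n+n≡m (m^n>0 2 ℓ)

1≤Mod : ∀ ℓ → 1 ≤ ℓ → 1 ≤ Mod ℓ
1≤Mod (suc ℓ) _ = +-cancelʳ-≤ 1 1 (Mod (suc ℓ)) (subst (2 ≤_) (sym (Mod+1≡2^ (suc ℓ))) (*-monoʳ-≤ 2 (m^n>0 2 ℓ)))

<2^⇒≤Mod : ∀ ℓ {x} → x < 2 ^ ℓ → x ≤ Mod ℓ
<2^⇒≤Mod ℓ {x} x<2^ℓ = +-cancelʳ-≤ 1 x (Mod ℓ) (subst₂ _≤_ (+-comm 1 x) (sym (Mod+1≡2^ ℓ)) x<2^ℓ)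

2^ℓ*z≡Mod*z+z : ∀ ℓ z → 2 ^ ℓ * z ≡ Mod ℓ * z + z
2^ℓ*z≡Mod*z+z ℓ z = trans (cong (_* z) (sym (Mod+1≡2^ ℓ)))
  (trans (*-distribʳ-+ z (Mod ℓ) 1) (cong (Mod ℓ * z +_) (*-identityˡ z)))

quotient-unique : ∀ M x y B → x < M → y ≤ M → M * x + x ≡ y + M * B → B ≡ x × y ≡ x
quotient-unique M x y B x<M y≤M eq with <-cmp B x
... | tri≈ _ refl _ = refl , +-cancelʳ-≡ (M * x) y x (trans (sym eq) (+-comm (M * x) x))
... | tri< B<x _ _ = ⊥-elim (<⇒≢ (begin-strict
      y + M * B  ≤⟨ +-monoˡ-≤ (M * B) y≤M ⟩
      M + M * B  ≡⟨ *-suc M B ⟨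
      M * suc B  ≤⟨ *-monoʳ-≤ M B<x ⟩
      M * x      <⟨ m<m+n (M * x) (≤-<-trans z≤n B<x) ⟩
      M * x + x  ∎) (sym eq))
  where open ≤-Reasoning
... | tri> _ _ x<B = ⊥-elim (<⇒≢ (begin-strict
      M * x + x  <⟨ +-monoʳ-< (M * x) x<M ⟩
      M * x + M  ≡⟨ +-comm (M * x) M ⟩
      M + M * x  ≡⟨ *-suc M x ⟨
      M * suc x  ≤⟨ *-monoʳ-≤ M x<B ⟩
      M * B      ≤⟨ m≤n+m (M * B) y ⟩
      y + M * B  ∎) eq)
  where open ≤-Reasoning

module _ (ℓ : ℕ) {x : ℕ} (x≤Mod : x ≤ Mod ℓ) where

  private
    M = Mod ℓ

  2^r*x≡δ^r+Mod*carries : ∀ r → 2 ^ r * x ≡ δ^ ℓ r x + M * carries ℓ x r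
  2^r*x≡δ^r+Mod*carries zero    = trans (+-identityʳ x) (sym (trans (cong (x +_) (*-zeroʳ M)) (+-identityʳ x)))
  2^r*x≡δ^r+Mod*carries (suc r) = begin
    2 ^ suc r * x                         ≡⟨ *-assoc 2 (2 ^ r) x ⟩
    2 * (2 ^ r * x)                       ≡⟨ cong (2 *_) (2^r*x≡δ^r+Mod*carries r) ⟩
    2 * (y + M * B)                       ≡⟨ double-distrib y M B ⟩
    2 * y + M * (2 * B)                   ≡⟨ cong (_+ M * (2 * B)) (δ+Mod*carry≡2* ℓ (δ^≤Mod ℓ r x≤Mod)) ⟨
    (δ ℓ y + M * carry ℓ y) + M * (2 * B) ≡⟨ regroup (δ ℓ y) M (carry ℓ y) B ⟩
    δ ℓ y + M * (2 * B + carry ℓ y)       ∎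
    where
    open ≡-Reasoning
    y = δ^ ℓ r x
    B = carries ℓ x r
    double-distrib : ∀ y M B → 2 * (y + M * B) ≡ 2 * y + M * (2 * B)
    double-distrib = solve-∀
    regroup : ∀ z M c B → (z + M * c) + M * (2 * B) ≡ z + M * (2 * B + c)
    regroup = solve-∀

  s₂-carries : ∀ r → s₂ (carries ℓ x r) ≡ sumTo r (λ k → carry ℓ (δ^ ℓ k x))
  s₂-carries zero    = refl
  s₂-carries (suc r) = trans (s₂[2y+b]≡b+s₂[y] (carries ℓ x r) _ (carry≤1 ℓ (δ^≤Mod ℓ r x≤Mod)))
    (trans (+-comm (carry ℓ (δ^ ℓ r x)) _) (cong (_+ carry ℓ (δ^ ℓ r x)) (s₂-carries r)))

  carries-period : 1 ≤ ℓ → carries ℓ x ℓ ≡ x × δ^ ℓ ℓ x ≡ x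
  carries-period 1≤ℓ with m≤n⇒m<n∨m≡n x≤Mod
  ... | inj₁ x<M  = quotient-unique M x (δ^ ℓ ℓ x) (carries ℓ x ℓ) x<M (δ^≤Mod ℓ ℓ x≤Mod)
                      (trans (sym (2^ℓ*z≡Mod*z+z ℓ x)) (2^r*x≡δ^r+Mod*carries ℓ))
  ... | inj₂ refl = *-cancelˡ-≡ (carries ℓ M ℓ) M M {{>-nonZero (1≤Mod ℓ 1≤ℓ)}}
                      (+-cancelˡ-≡ M _ _ (begin
                        M + M * carries ℓ M ℓ        ≡⟨ cong (_+ M * carries ℓ M ℓ) (δ^-Mod ℓ ℓ) ⟨
                        δ^ ℓ ℓ M + M * carries ℓ M ℓ ≡⟨ 2^r*x≡δ^r+Mod*carries ℓ ⟨
                        2 ^ ℓ * M                    ≡⟨ 2^ℓ*z≡Mod*z+z ℓ M ⟩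
                        M * M + M                    ≡⟨ +-comm (M * M) M ⟩
                        M + M * M                    ∎))
                    , δ^-Mod ℓ ℓ
    where open ≡-Reasoning

jump : (ℕ → ℕ) → ℕ → ℕ
jump g i = ind (g (suc i) <ᵇ 2 * g i)

jump≡0 : ∀ g i → g (suc i) ≡ 2 * g i → jump g i ≡ 0
jump≡0 g i eq with g (suc i) <ᵇ 2 * g i in lt
... | false = refl
... | true  = ⊥-elim (<⇒≢ (<ᵇ⇒< _ _ (subst T (sym lt) _)) eq)

jump≡1⇒< : ∀ g i → jump g i ≡ 1 → g (suc i) < 2 * g i
jump≡1⇒< g i eq with g (suc i) <ᵇ 2 * g i in lt
... | true  = <ᵇ⇒< _ _ (subst T (sym lt) _)
... | false = ⊥-elim (0≢1+n eq)

jumps≡sumTo-jump : ∀ m d ℓ u → jumps m d ℓ u ≡ sumTo ℓ (jump (φ m d ℓ u))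
jumps≡sumTo-jump m d ℓ u = countBelow≡sumTo ℓ _

module Support (m : ℕ) (d : Fin m → ℕ) (ℓ : ℕ) (u : Fin m → ℕ) (1≤ℓ : 1 ≤ ℓ)
               (u≤Mod : ∀ j → u j ≤ Mod ℓ) (Mod∣total : Mod ℓ ∣ total m d u) where

  private
    M = Mod ℓ
    f = φ m d ℓ u
    instance
      Mod≢0 : NonZero M
      Mod≢0 = >-nonZero (1≤Mod ℓ 1≤ℓ)
      ℓ≢0 : NonZero ℓ
      ℓ≢0 = >-nonZero 1≤ℓ

  -- S k = (2^ℓ - 1) φ(k); C k and N k are the sum and the number of the d carried at step k.
  S C N : ℕ → ℕ
  S k = ∑ m (λ j → d j * δ^ ℓ k (u j))
  C k = ∑ m (λ j → d j * carry ℓ (δ^ ℓ k (u j)))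
  N k = ∑ m (λ j → carry ℓ (δ^ ℓ k (u j)))

  S-step : ∀ k → S (suc k) + M * C k ≡ 2 * S k
  S-step k = begin
    S (suc k) + M * C k                                ≡⟨ cong (S (suc k) +_) (*-distribˡ-∑ m M _) ⟩
    S (suc k) + ∑ m (λ j → M * (d j * c j))            ≡⟨ ∑-distrib-+ m _ _ ⟨
    ∑ m (λ j → d j * δ ℓ (y j) + M * (d j * c j))      ≡⟨ ∑-cong m (λ j → scale (d j) (y j) (δ ℓ (y j)) M (c j)
                                                                             (δ+Mod*carry≡2* ℓ (δ^≤Mod ℓ k (u≤Mod j)))) ⟩
    ∑ m (λ j → 2 * (d j * y j))                        ≡⟨ *-distribˡ-∑ m 2 _ ⟨
    2 * S k                                            ∎
    where
    open ≡-Reasoning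
    y c : Fin m → ℕ
    y j = δ^ ℓ k (u j)
    c j = carry ℓ (y j)
    scale : ∀ D y z M c → z + M * c ≡ 2 * y → D * z + M * (D * c) ≡ 2 * (D * y)
    scale D y z M c eq = trans (lhs D z M c) (trans (cong (D *_) eq) (rhs D y))
      where
      lhs : ∀ D z M c → D * z + M * (D * c) ≡ D * (z + M * c)
      lhs = solve-∀
      rhs : ∀ D y → D * (2 * y) ≡ 2 * (D * y)
      rhs = solve-∀

  Mod∣S : ∀ k → M ∣ S k
  Mod∣S zero    = Mod∣total
  Mod∣S (suc k) = ∣m+n∣m⇒∣n (subst (M ∣_) (trans (sym (S-step k)) (+-comm (S (suc k)) _)) (∣n⇒∣m*n 2 (Mod∣S k)))
                            (m∣m*n (C k))

  Mod*φ≡S : ∀ k → M * f k ≡ S k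
  Mod*φ≡S k = divw-exact (S k) M (1≤Mod ℓ 1≤ℓ) (Mod∣S k)

  φ-step : ∀ k → f (suc k) + C k ≡ 2 * f k
  φ-step k = *-cancelˡ-≡ _ _ M (begin
    M * (f (suc k) + C k)      ≡⟨ *-distribˡ-+ M (f (suc k)) (C k) ⟩
    M * f (suc k) + M * C k    ≡⟨ cong (_+ M * C k) (Mod*φ≡S (suc k)) ⟩
    S (suc k) + M * C k        ≡⟨ S-step k ⟩
    2 * S k                    ≡⟨ cong (2 *_) (Mod*φ≡S k) ⟨
    2 * (M * f k)              ≡⟨ *-comm 2 (M * f k) ⟩
    M * f k * 2                ≡⟨ *-assoc M (f k) 2 ⟩
    M * (f k * 2)              ≡⟨ cong (M *_) (*-comm (f k) 2) ⟩
    M * (2 * f k)              ∎)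
    where open ≡-Reasoning

  δ^-periodic : ∀ j → Periodic ℓ (λ k → δ^ ℓ k (u j))
  δ^-periodic j k = trans (δ^-+ ℓ k ℓ (u j)) (cong (δ^ ℓ k) (proj₂ (carries-period ℓ (u≤Mod j) 1≤ℓ)))

  φ-periodic : Periodic ℓ f
  φ-periodic k = *-cancelˡ-≡ _ _ M (trans (Mod*φ≡S (k + ℓ))
    (trans (∑-cong m (λ j → cong (d j *_) (δ^-periodic j k))) (sym (Mod*φ≡S k))))

  N-periodic : Periodic ℓ N
  N-periodic k = ∑-cong m (λ j → cong (carry ℓ) (δ^-periodic j k))

  weight≡sumTo-N : weight m u ≡ sumTo ℓ N
  weight≡sumTo-N = trans (∑-cong m λ j → trans (cong s₂ (sym (proj₁ (carries-period ℓ (u≤Mod j) 1≤ℓ))))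
                                              (s₂-carries ℓ (u≤Mod j) ℓ))
                         (∑-sumTo-comm m ℓ (λ j k → carry ℓ (δ^ ℓ k (u j))))

  jump≤N : ∀ k → jump f k ≤ N k
  jump≤N k with N k in N≡
  ... | suc _ = ≤-trans (ind≤1 _) (s≤s z≤n)
  ... | zero  = ≤-reflexive (jump≡0 f k (trans (sym (+-identityʳ _)) (trans (cong (f (suc k) +_) (sym C≡0)) (φ-step k))))
    where
    C≡0 : C k ≡ 0
    C≡0 = ∑-zero m λ j → trans (cong (d j *_) (∑≡0⇒≡0 m _ N≡ j)) (*-zeroʳ (d j))

  C≡0⊎C≡d : weight m u ≡ jumps m d ℓ u → ∀ k → C k ≡ 0 ⊎ ∃[ j ] C k ≡ d j
  C≡0⊎C≡d weight≡jumps k =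
    ∑-*-atMostOne m d _ (λ j → carry≤1 ℓ (δ^≤Mod ℓ k (u≤Mod j))) N≤1
    where
    jump≡N : ∀ k → k < ℓ → jump f k ≡ N k
    jump≡N = sumTo-≤-≡⇒≡ ℓ (λ k _ → jump≤N k)
      (trans (sym (jumps≡sumTo-jump m d ℓ u)) (trans (sym weight≡jumps) weight≡sumTo-N))
    N≤1 : N k ≤ 1
    N≤1 = subst (_≤ 1) (sym (trans (periodic-% ℓ N N-periodic k) (sym (jump≡N (k % ℓ) (m%n<n k ℓ))))) (ind≤1 _)

module Blocks (f c : ℕ → ℕ) (P ℓ w s : ℕ) (nb lb : ℕ → ℕ) (2≤w : 2 ≤ w)
  (step : ∀ k → f (suc k) + c k ≡ 2 * f k)
  (c-shape : ∀ k → c k ≡ 0 ⊎ Odd (c k) × c k < P)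
  (periodic : Periodic ℓ f) (injective : InjectiveBelow ℓ f)
  (jumps≡w : sumTo ℓ (jump f) ≡ w)
  (form : BlockForm f ℓ w s nb lb) where

  private
    1≤lb : ∀ k → k < w → 1 ≤ lb k
    1≤lb = proj₁ form

    ∑lb≡ℓ : sumTo w lb ≡ ℓ
    ∑lb≡ℓ = proj₁ (proj₂ form)

    block-value : ∀ k t → k < w → t < lb k → f (s + sumTo k lb + t) ≡ 2 ^ t * nb k
    block-value = proj₂ (proj₂ form)

    offset<ℓ : ∀ k → k < w → sumTo k lb < ℓ
    offset<ℓ k k<w = subst (sumTo k lb <_) ∑lb≡ℓ (sumTo-monoˡ-< lb 1≤lb k<w)

    instance
      w≢0 : NonZero w
      w≢0 = >-nonZero (≤-trans (s≤s z≤n) 2≤w)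
      ℓ≢0 : NonZero ℓ
      ℓ≢0 = >-nonZero (≤-<-trans z≤n (offset<ℓ 0 (≤-trans (s≤s z≤n) 2≤w)))

  start end Lb : ℕ → ℕ
  start k = s + sumTo k lb
  Lb k = lb k ∸ 1
  end k = start k + Lb k

  lb≡1+Lb : ∀ k → k < w → lb k ≡ suc (Lb k)
  lb≡1+Lb k k<w = n≡1+[n∸1] (1≤lb k k<w)

  f-start : ∀ k → k < w → f (start k) ≡ nb k
  f-start k k<w = trans (cong f (sym (+-identityʳ _))) (trans (block-value k 0 k<w (1≤lb k k<w)) (*-identityˡ (nb k)))

  f-end : ∀ k → k < w → f (end k) ≡ 2 ^ Lb k * nb k
  f-end k k<w = block-value k (Lb k) k<w (subst (Lb k <_) (sym (lb≡1+Lb k k<w)) ≤-refl)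

  f-after-end : ∀ k → k < w → f (suc (end k)) ≡ nb (suc k % w)
  f-after-end k k<w = trans (cong f 1+end≡start) (next-block (rotate-cases k<w))
    where
    1+end≡start : suc (end k) ≡ s + sumTo (suc k) lb
    1+end≡start = trans (sym (+-suc (start k) (Lb k)))
      (trans (cong (start k +_) (sym (lb≡1+Lb k k<w))) (+-assoc s (sumTo k lb) (lb k)))
    next-block : (suc k < w × suc k % w ≡ suc k) ⊎ (suc k ≡ w × suc k % w ≡ 0) →
                 f (s + sumTo (suc k) lb) ≡ nb (suc k % w)
    next-block (inj₁ (1+k<w , r≡)) = trans (f-start (suc k) 1+k<w) (cong nb (sym r≡))
    next-block (inj₂ (1+k≡w , r≡)) = begin
      f (s + sumTo (suc k) lb)   ≡⟨ cong (λ i → f (s + sumTo i lb)) 1+k≡w ⟩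
      f (s + sumTo w lb)         ≡⟨ cong (λ L → f (s + L)) ∑lb≡ℓ ⟩
      f (s + ℓ)                  ≡⟨ periodic s ⟩
      f s                        ≡⟨ cong f (sym (+-identityʳ s)) ⟩
      f (start 0)                ≡⟨ f-start 0 (≤-trans (s≤s z≤n) 2≤w) ⟩
      nb 0                       ≡⟨ cong nb (sym r≡) ⟩
      nb (suc k % w)             ∎
      where open ≡-Reasoning

  jumps-in-block : ∀ k → k < w → sumTo (lb k) (λ t → jump f (start k + t)) ≡ jump f (end k)
  jumps-in-block k k<w = trans (cong (λ L → sumTo L g) (lb≡1+Lb k k<w))
    (cong (_+ g (Lb k)) (sumTo-zero (Lb k) λ t t<Lb → jump≡0 f (start k + t) (doubles t t<Lb)))
    where
    g : ℕ → ℕ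
    g t = jump f (start k + t)
    doubles : ∀ t → t < Lb k → f (suc (start k + t)) ≡ 2 * f (start k + t)
    doubles t t<Lb = begin
      f (suc (start k + t))   ≡⟨ cong f (sym (+-suc (start k) t)) ⟩
      f (start k + suc t)     ≡⟨ block-value k (suc t) k<w (subst (suc t <_) (sym (lb≡1+Lb k k<w)) (s≤s t<Lb)) ⟩
      2 ^ suc t * nb k        ≡⟨ *-assoc 2 (2 ^ t) (nb k) ⟩
      2 * (2 ^ t * nb k)      ≡⟨ cong (2 *_) (block-value k t k<w (subst (t <_) (sym (lb≡1+Lb k k<w)) (m<n⇒m<1+n t<Lb))) ⟨
      2 * f (start k + t)     ∎
      where open ≡-Reasoning

  jumps-by-block : ∀ K → K ≤ w → sumTo (sumTo K lb) (λ t → jump f (s + t)) ≡ sumTo K (λ k → jump f (end k))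
  jumps-by-block zero    _     = refl
  jumps-by-block (suc K) 1+K≤w = begin
    sumTo (sumTo K lb + lb K) (λ t → jump f (s + t))
      ≡⟨ sumTo-split (sumTo K lb) (lb K) (λ t → jump f (s + t)) ⟩
    sumTo (sumTo K lb) (λ t → jump f (s + t)) + sumTo (lb K) (λ t → jump f (s + (sumTo K lb + t)))
      ≡⟨ cong₂ _+_ (jumps-by-block K (<⇒≤ 1+K≤w)) (sumTo-cong (lb K) λ t _ → cong (jump f) (sym (+-assoc s _ t))) ⟩
    sumTo K (λ k → jump f (end k)) + sumTo (lb K) (λ t → jump f (start K + t))
      ≡⟨ cong (sumTo K (λ k → jump f (end k)) +_) (jumps-in-block K 1+K≤w) ⟩
    sumTo K (λ k → jump f (end k)) + jump f (end K) ∎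
    where open ≡-Reasoning

  every-block-jumps : ∀ k → k < w → jump f (end k) ≡ 1
  every-block-jumps = sumTo-≤-≡⇒≡ w (λ k _ → ind≤1 _) (begin
    sumTo w (λ k → jump f (end k))                   ≡⟨ jumps-by-block w ≤-refl ⟨
    sumTo (sumTo w lb) (λ t → jump f (s + t))        ≡⟨ cong (λ L → sumTo L (λ t → jump f (s + t))) ∑lb≡ℓ ⟩
    sumTo ℓ (λ t → jump f (s + t))                   ≡⟨ sumTo-shift-periodic ℓ (jump f) jump-periodic s ⟩
    sumTo ℓ (jump f)                                 ≡⟨ jumps≡w ⟩
    w                                                ≡⟨ trans (sumTo-const w 1) (*-identityʳ w) ⟨
    sumTo w (λ _ → 1)                                ∎)
    where
    open ≡-Reasoning
    jump-periodic : Periodic ℓ (jump f)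
    jump-periodic k = cong₂ (λ a b → ind (a <ᵇ 2 * b)) (periodic (suc k)) (periodic k)

  carry-at-end : ∀ k → k < w → Odd (c (end k)) × c (end k) < P
  carry-at-end k k<w with c-shape (end k)
  ... | inj₂ odd-c = odd-c
  ... | inj₁ c≡0   = ⊥-elim (<⇒≢ (jump≡1⇒< f (end k) (every-block-jumps k k<w))
                      (trans (sym (+-identityʳ _)) (trans (cong (f (suc (end k)) +_) (sym c≡0)) (step (end k)))))

  transition : ∀ k → k < w → nb (suc k % w) + c (end k) ≡ 2 * (2 ^ Lb k * nb k)
  transition k k<w = trans (cong (_+ c (end k)) (sym (f-after-end k k<w)))
    (trans (step (end k)) (cong (2 *_) (f-end k k<w)))

  nb-odd : ∀ k → k < w → Odd (nb k)
  nb-odd k k<w with rotate-surjective w k k<w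
  ... | K , K<w , refl = odd-summand (nb (suc K % w)) (2 ^ Lb K * nb K) (proj₁ (carry-at-end K K<w)) (transition K K<w)

  offset-< : ∀ {j k} → j < k → k < w → sumTo j lb < sumTo k lb
  offset-< j<k k<w = sumTo-monoˡ-< lb (λ i i<k → 1≤lb i (<-trans i<k k<w)) j<k

  offset-injective : ∀ j k → j < w → k < w → nb j ≡ nb k → sumTo j lb ≡ sumTo k lb
  offset-injective j k j<w k<w eq = window-injective ℓ f periodic injective s _ _ (offset<ℓ j j<w) (offset<ℓ k k<w)
    (trans (f-start j j<w) (trans eq (sym (f-start k k<w))))

  nb-injective : InjectiveBelow w nb
  nb-injective j k j<w k<w eq with <-cmp j k
  ... | tri≈ _ j≡k _ = j≡k
  ... | tri< j<k _ _ = ⊥-elim (<⇒≢ (offset-< j<k k<w) (offset-injective j k j<w k<w eq))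
  ... | tri> _ _ k<j = ⊥-elim (<⇒≢ (offset-< k<j j<w) (offset-injective k j k<w j<w (sym eq)))

  successor : ∀ K → K < w → ∃[ K′ ] (K′ < w × K′ ≢ K × ∃[ d ] (d < P × nb K′ + d ≡ 2 ^ lb K * nb K))
  successor K K<w = suc K % w , m%n<n (suc K) w , σK≢K (rotate-cases K<w)
                  , c (end K) , proj₂ (carry-at-end K K<w)
                  , trans (transition K K<w) (sym (2^n*x≡2*[2^[n∸1]*x] (nb K) (1≤lb K K<w)))
    where
    σK≢K : (suc K < w × suc K % w ≡ suc K) ⊎ (suc K ≡ w × suc K % w ≡ 0) → suc K % w ≢ K
    σK≢K (inj₁ (_ , r≡)) eq = 1+n≢n (trans (sym r≡) eq)
    σK≢K (inj₂ (1+K≡w , r≡)) eq with trans (sym r≡) eq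
    ... | refl = <⇒≱ 2≤w (≤-reflexive (sym 1+K≡w))

module Arithmetic (n ℓ w : ℕ) (nb lb : ℕ → ℕ) (60≤n : 60 ≤ n) (2≤w : 2 ≤ w)
  (1≤lb : ∀ k → k < w → 1 ≤ lb k) (∑lb≡ℓ : sumTo w lb ≡ ℓ) (density : (n ∸ 1) * w ≤ ℓ)
  (nb-odd : ∀ k → k < w → Odd (nb k))
  (successor : ∀ K → K < w → ∃[ K′ ] (K′ < w × K′ ≢ K × ∃[ d ] (d < 2 ^ suc n × nb K′ + d ≡ 2 ^ lb K * nb K)))
  (nb-injective : InjectiveBelow w nb) where

  top : ℕ → ℕ
  top k = 2 ^ (lb k ∸ 1) * nb k

  2^lb*nb≡top+top : ∀ k → k < w → 2 ^ lb k * nb k ≡ top k + top k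
  2^lb*nb≡top+top k k<w = trans (2^n*x≡2*[2^[n∸1]*x] (nb k) (1≤lb k k<w)) (cong (top k +_) (+-identityʳ (top k)))

  1≤nb : ∀ k → k < w → 1 ≤ nb k
  1≤nb k k<w with nb-odd k k<w
  ... | q , eq = subst (1 ≤_) (sym eq) (s≤s z≤n)

  nb≤top : ∀ k → nb k ≤ top k
  nb≤top k = m≤n*m (nb k) (2 ^ (lb k ∸ 1)) {{m^n≢0 2 (lb k ∸ 1)}}

  top<2^[1+n] : ∀ k → k < w → top k < 2 ^ suc n
  top<2^[1+n] k k<w with argmax w (≤-trans (s≤s z≤n) 2≤w) top
  ... | K , K<w , max with successor K K<w
  ...   | K′ , K′<w , _ , d , d< , eq = ≤-<-trans (max k k<w) (+-cancelˡ-< (top K) (top K) (2 ^ suc n) (begin-strict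
    top K + top K        ≡⟨ trans eq (2^lb*nb≡top+top K K<w) ⟨
    nb K′ + d            <⟨ +-mono-≤-< (≤-trans (nb≤top K′) (max K′ K′<w)) d< ⟩
    top K + 2 ^ suc n    ∎))
    where open ≤-Reasoning

  lb-bound : ∀ k c → k < w → 2 ^ c ≤ nb k → lb k + c ≤ suc n
  lb-bound k c k<w 2^c≤nb = subst (λ e → e + c ≤ suc n) (sym (n≡1+[n∸1] (1≤lb k k<w)))
    (exponent-bound (lb k ∸ 1) c (nb k) (suc n) 2^c≤nb (top<2^[1+n] k k<w))

  lb≤1+n : ∀ k → k < w → lb k ≤ suc n
  lb≤1+n k k<w = subst (_≤ suc n) (+-identityʳ (lb k)) (lb-bound k 0 k<w (1≤nb k k<w))

  deficit : ℕ → ℕ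
  deficit k = suc n ∸ lb k

  deficit+lb : ∀ k → k < w → deficit k + lb k ≡ suc n
  deficit+lb k k<w = m∸n+n≡m (lb≤1+n k k<w)

  ∑deficit≤2w : sumTo w deficit ≤ 2 * w
  ∑deficit≤2w = +-cancelʳ-≤ ℓ _ _ (begin
    sumTo w deficit + ℓ                  ≡⟨ cong (sumTo w deficit +_) ∑lb≡ℓ ⟨
    sumTo w deficit + sumTo w lb         ≡⟨ sumTo-distrib-+ w deficit lb ⟨
    sumTo w (λ k → deficit k + lb k)     ≡⟨ sumTo-cong w deficit+lb ⟩
    sumTo w (λ _ → suc n)                ≡⟨ sumTo-const w (suc n) ⟩
    w * suc n                            ≡⟨ cong (λ m → w * suc m) (n≡1+[n∸1] (≤-trans (s≤s z≤n) 60≤n)) ⟩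
    w * (2 + (n ∸ 1))                    ≡⟨ split w (n ∸ 1) ⟩
    (n ∸ 1) * w + 2 * w                  ≤⟨ +-monoˡ-≤ (2 * w) density ⟩
    ℓ + 2 * w                            ≡⟨ +-comm ℓ (2 * w) ⟩
    2 * w + ℓ                            ∎)
    where
    open ≤-Reasoning
    split : ∀ w m → w * (2 + m) ≡ m * w + 2 * w
    split = solve-∀

  3≤deficit : ∀ k → k < w → 9 ≤ nb k → 3 ≤ deficit k
  3≤deficit k k<w 9≤nb = +-cancelʳ-≤ (lb k) 3 (deficit k)
    (subst₂ _≤_ (+-comm (lb k) 3) (sym (deficit+lb k k<w)) (lb-bound k 3 k<w (≤-trans (n≤1+n 8) 9≤nb)))

  w≤27 : w ≤ 27
  w≤27 = +-cancelˡ-≤ (2 * w) w 27 (begin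
    2 * w + w                                                     ≡⟨ triple w ⟩
    w * 3                                                         ≡⟨ sumTo-const w 3 ⟨
    sumTo w (λ _ → 3)                                             ≤⟨ sumTo-mono-≤ w three≤ ⟩
    sumTo w (λ k → deficit k + 3 * small k)                       ≡⟨ sumTo-distrib-+ w deficit _ ⟩
    sumTo w deficit + sumTo w (λ k → 3 * small k)                 ≡⟨ cong (sumTo w deficit +_) (*-distribˡ-sumTo w 3 small) ⟨
    sumTo w deficit + 3 * sumTo w small                           ≤⟨ +-mono-≤ ∑deficit≤2w
                                                                         (*-monoʳ-≤ 3 (count-<-injective w nb 9 nb-injective)) ⟩
    2 * w + 27                                                    ∎)
    where
    open ≤-Reasoning
    small : ℕ → ℕ
    small k = ind (nb k <ᵇ 9)
    triple : ∀ w → 2 * w + w ≡ w * 3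
    triple = solve-∀
    three≤ : ∀ k → k < w → 3 ≤ deficit k + 3 * small k
    three≤ k k<w with nb k <ᵇ 9 in nb<ᵇ9
    ... | true  = m≤n+m 3 (deficit k)
    ... | false = ≤-trans (3≤deficit k k<w (≮⇒≥ λ nb<9 → subst T nb<ᵇ9 (<⇒<ᵇ nb<9))) (m≤m+n (deficit k) 0)

  distinct-blocks-long : ∀ j k → j < w → k < w → j ≢ k → lb j + lb k ≤ suc n → ⊥
  distinct-blocks-long j k j<w k<w j≢k short = <⇒≱ (m≤n+m 55 5) (begin
    60                        ≤⟨ 60≤n ⟩
    n                         ≤⟨ n≤1+n n ⟩
    suc n                     ≤⟨ +-cancelʳ-≤ (lb j + lb k) (suc n) _ (begin
        suc n + (lb j + lb k)                 ≤⟨ +-monoʳ-≤ (suc n) short ⟩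
        suc n + suc n                         ≡⟨ cong₂ _+_ (deficit+lb j j<w) (deficit+lb k k<w) ⟨
        (deficit j + lb j) + (deficit k + lb k) ≡⟨ interchange (deficit j) (lb j) (deficit k) (lb k) ⟩
        (deficit j + deficit k) + (lb j + lb k) ∎) ⟩
    deficit j + deficit k     ≤⟨ pair≤sumTo w deficit j k j<w k<w j≢k ⟩
    sumTo w deficit           ≤⟨ ∑deficit≤2w ⟩
    2 * w                     ≤⟨ *-monoʳ-≤ 2 w≤27 ⟩
    54                        ∎)
    where open ≤-Reasoning

  lb+v≤n : ∀ k v → k < w → nb k > 2 ^ v → lb k + v ≤ n
  lb+v≤n k v k<w 2^v<nb with lb k + v ≤? n
  ... | yes short = short
  ... | no  long  with successor k k<w
  ...   | K′ , K′<w , K′≢k , d , d< , eq =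
    ⊥-elim (distinct-blocks-long K′ k K′<w k<w K′≢k (lb-bound K′ (lb k) K′<w (<⇒≤ 2^lb<nbK′)))
    where
    open ≤-Reasoning
    A = 2 ^ lb k
    2^lb<nbK′ : A < nb K′
    2^lb<nbK′ = +-cancelʳ-< d A (nb K′) (begin-strict
      A + d                 ≡⟨ +-comm A d ⟩
      d + A                 <⟨ +-monoˡ-< A d< ⟩
      2 ^ suc n + A         ≤⟨ +-monoˡ-≤ A (^-monoʳ-≤ 2 (≰⇒> long)) ⟩
      2 ^ (lb k + v) + A    ≡⟨ cong (_+ A) (^-distribˡ-+-* 2 (lb k) v) ⟩
      A * 2 ^ v + A         ≡⟨ +-comm (A * 2 ^ v) A ⟩
      A + A * 2 ^ v         ≡⟨ *-suc A (2 ^ v) ⟨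
      A * suc (2 ^ v)       ≤⟨ *-monoʳ-≤ A 2^v<nb ⟩
      A * nb k              ≡⟨ eq ⟨
      nb K′ + d             ∎)

  long-block-starts-at-1 : ∀ i → i < w → n ≤ lb i → nb i ≡ 1
  long-block-starts-at-1 i i<w n≤lb with nb-odd i i<w
  ... | zero  , nb≡1 = nb≡1
  ... | suc q , nb≡  = ⊥-elim (<⇒≱ (subst (_≤ n) (+-comm (lb i) 1) (lb+v≤n i 1 i<w 2<nb)) n≤lb)
    where
    2<nb : nb i > 2 ^ 1
    2<nb = subst (_> 2) (sym nb≡) (s≤s (*-monoʳ-≤ 2 (s≤s {0} {q} z≤n)))

  long-block-unique : ∀ i → i < w → n ≤ lb i → ∀ j → j < w → j ≢ i → lb j < n
  long-block-unique i i<w n≤lbi j j<w j≢i with lb j <? n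
  ... | yes lbj<n = lbj<n
  ... | no  lbj≮n = ⊥-elim (j≢i (nb-injective j i j<w i<w
          (trans (long-block-starts-at-1 j j<w (≮⇒≥ lbj≮n)) (sym (long-block-starts-at-1 i i<w n≤lbi)))))

  next-longest-starts-at-3 : ∀ i → i < w → n ≤ lb i → ∀ j → j < w → suc (lb j) ≡ n → nb j ≡ 3
  next-longest-starts-at-3 i i<w n≤lbi j j<w 1+lbj≡n with nb-odd j j<w
  ... | zero , nbj≡1 = ⊥-elim (<⇒≱ (≤-reflexive 1+lbj≡n) (subst (λ k → n ≤ lb k) (sym j≡i) n≤lbi))
    where
    j≡i : j ≡ i
    j≡i = nb-injective j i j<w i<w (trans nbj≡1 (sym (long-block-starts-at-1 i i<w n≤lbi)))
  ... | suc zero , nbj≡3 = nbj≡3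
  ... | suc (suc q) , nbj≡ = ⊥-elim (<⇒≱ (n<1+n (suc (lb j)))
          (subst (_≤ suc (lb j)) (+-comm (lb j) 2) (subst (lb j + 2 ≤_) (sym 1+lbj≡n) (lb+v≤n j 2 j<w 4<nb))))
    where
    4<nb : nb j > 2 ^ 2
    4<nb = subst (_> 4) (sym nbj≡) (s≤s (*-monoʳ-≤ 2 (s≤s {1} {suc q} (s≤s z≤n))))

  next-longest-unique : ∀ i → i < w → n ≤ lb i →
                        ∀ j j′ → j < w → j′ < w → suc (lb j) ≡ n → suc (lb j′) ≡ n → j ≡ j′
  next-longest-unique i i<w n≤lbi j j′ j<w j′<w eq eq′ = nb-injective j j′ j<w j′<w
    (trans (next-longest-starts-at-3 i i<w n≤lbi j j<w eq) (sym (next-longest-starts-at-3 i i<w n≤lbi j′ j′<w eq′)))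

Delt<2^[1+n] : ∀ n (j : Fin (Dsize n)) → Delt n j < 2 ^ suc n
Delt<2^[1+n] n j = subst (_≤ 2 ^ suc n) (2*[1+t] (toℕ j)) (*-monoʳ-≤ 2 (≤-trans (toℕ<n j) (m∸n≤m (2 ^ n) 1)))
  where
  2*[1+t] : ∀ t → 2 * suc t ≡ suc (suc (2 * t))
  2*[1+t] = solve-∀

lemma2p4 : ∃[ N ] ∀ (n : ℕ) → N ≤ n →
    ∀ (ℓ : ℕ) (u : Fin (Dsize n) → ℕ) (w : ℕ) →
    InE (Dsize n) (Delt n) ℓ u →
    Irreducible (Dsize n) (Delt n) ℓ u →
    weight (Dsize n) u ≡ w →
    2 ≤ w →
    (n ∸ 1) * w ≤ ℓ →
    ℓ ≤ n * w →
    jumps (Dsize n) (Delt n) ℓ u ≡ w →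
    ∀ (s : ℕ) (nb lb : ℕ → ℕ) →
    BlockForm (φ (Dsize n) (Delt n) ℓ u) ℓ w s nb lb →
    (∀ k → k < w → lb k ≤ suc n) ×
    ((∀ k → k < w → ∃[ q ] nb k ≡ suc (2 * q)) ×
     ((∀ k v → k < w → 1 ≤ v → nb k > 2 ^ v → lb k + v ≤ n) ×
      (∀ i → i < w → n ≤ lb i →
        (nb i ≡ 1) ×
        ((∀ j → j < w → j ≢ i → lb j < n) ×
         ((∀ j j′ → j < w → j′ < w → suc (lb j) ≡ n → suc (lb j′) ≡ n → j ≡ j′) ×
          (∀ j → j < w → suc (lb j) ≡ n → nb j ≡ 3))))))
lemma2p4 = 60 , λ n 60≤n ℓ u w (1≤ℓ , u<2^ℓ , Mod∣total , _) irreducible weight≡w 2≤w density _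
                  jumps≡w s nb lb form →
  let open Support (Dsize n) (Delt n) ℓ u 1≤ℓ (λ j → <2^⇒≤Mod ℓ (u<2^ℓ j)) Mod∣total
      C-shape : ∀ k → C k ≡ 0 ⊎ Odd (C k) × C k < 2 ^ suc n
      C-shape k = map₂ (λ { (j , C≡d) → (toℕ j , C≡d) , subst (_< 2 ^ suc n) (sym C≡d) (Delt<2^[1+n] n j) })
                       (C≡0⊎C≡d (trans weight≡w (sym jumps≡w)) k)
      module B = Blocks (φ (Dsize n) (Delt n) ℓ u) C (2 ^ suc n) ℓ w s nb lb 2≤w φ-step C-shape φ-periodic
                   irreducible (trans (sym (jumps≡sumTo-jump (Dsize n) (Delt n) ℓ u)) jumps≡w) form
      open Arithmetic n ℓ w nb lb 60≤n 2≤w (proj₁ form) (proj₁ (proj₂ form)) density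
                      B.nb-odd B.successor B.nb-injective
  in lb≤1+n , B.nb-odd , (λ k v k<w _ → lb+v≤n k v k<w)
   , λ i i<w n≤lb → long-block-starts-at-1 i i<w n≤lb , long-block-unique i i<w n≤lb
                  , next-longest-unique i i<w n≤lb , next-longest-starts-at-3 i i<w n≤lb
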